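{- Let $L$ be a Latin square of order $n$ with entries in $[n]$, and let $A\subseteq[n]$ with $|A|=a\ge 4$. Then for every integer $0\le b\le a$, $A$ contains a subset $B$ of size $b$ such that \[ |B'|\ge b(b-1)\left(1-\frac{b-2}{a-2}-\frac{(b-2)(b-3)}{2(a-3)}\right)-n_2(B). \]
   Context: A Latin square of order $n$ is an $n\times n$ matrix $L$ with entries from a set of $n$ elements such that each element appears exactly once in each row and each column; rows and columns are indexed by $[n]$. For $B\subseteq[n]$, $B'=\{L_{ij}: i,j\in B,\ i\ne j\}$, and $n_2(B)$ is the number of unordered pairs $\{i,j\}$ of distinct elements $i,j\in B$ with $L_{ij}=L_{ji}$. -}

module Defs where

open import Data.Nat as ℕ using (ℕ; zero; suc)
open import Data.Integer as ℤ using (ℤ; +_)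
open import Data.Rational as ℚ using (ℚ; _/_)
open import Data.Fin using (Fin; _<_)
open import Data.Fin.Properties using (any?; _≟_; _<?_)
open import Data.Fin.Subset using (Subset; _∈_)
open import Data.Fin.Subset.Properties using (_∈?_)
open import Data.Vec using (tabulate)
open import Data.List using (List; map)
open import Data.Nat.ListAction using (sum)
open import Data.List using () renaming (allFin to allFinL)
open import Data.Product using (_×_; ∃)
open import Data.Bool using (if_then_else_)
open import Function.Definitions using (Bijective)
open import Relation.Binary.PropositionalEquality using (_≡_; _≢_)
open import Relation.Nullary using (does; ¬?; _×-dec_)

LatinSquare : ℕ → Set
LatinSquare n = Fin n → Fin n → Fin n

IsLatinSquare : {n : ℕ} → LatinSquare n → Set
IsLatinSquare {n} L =
  ((i : Fin n) → Bijective _≡_ _≡_ (λ j → L i j)) ×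
  ((j : Fin n) → Bijective _≡_ _≡_ (λ i → L i j))

prime : {n : ℕ} → LatinSquare n → Subset n → Subset n
prime {n} L B = tabulate λ x →
  does (any? λ i → any? λ j →
          (i ∈? B) ×-dec (j ∈? B) ×-dec ¬? (i ≟ j) ×-dec (L i j ≟ x))

n₂ : {n : ℕ} → LatinSquare n → Subset n → ℕ
n₂ {n} L B = sum (map (λ i → sum (map (λ j →
  if does ((i <? j) ×-dec (i ∈? B) ×-dec (j ∈? B) ×-dec (L i j ≟ L j i))
  then 1 else 0) (allFinL n))) (allFinL n))

-- division of an integer by a natural number, as a rational.
-- (Only used with positive denominators; the zero case is a dummy value.)
_/ₙ_ : ℤ → ℕ → ℚ
p /ₙ zero = ℚ.0ℚ
p /ₙ suc d = p / suc d

ℕtoℚ : ℕ → ℚ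
ℕtoℚ k = + k / 1

ℤtoℚ : ℤ → ℚ
ℤtoℚ z = z / 1

-- b(b-1) (1 - (b-2)/(a-2) - (b-2)(b-3)/(2(a-3))), computed in ℚ with
-- integer (not truncated) subtraction.
bound : ℕ → ℕ → ℚ
bound a b =
  ℤtoℚ (+ b ℤ.* (+ b ℤ.- + 1)) ℚ.*
    (ℚ.1ℚ ℚ.- ((+ b ℤ.- + 2) /ₙ (a ℕ.∸ 2))
          ℚ.- (((+ b ℤ.- + 2) ℤ.* (+ b ℤ.- + 3)) /ₙ (2 ℕ.* (a ℕ.∸ 3))))

-- Let m(x) be the number of ordered pairs of distinct points of B with symbol x, so that
-- Σ m = b(b-1) and m(x) > 0 exactly for x ∈ B'. Summing 3m ≤ 2·[m > 0] + m² gives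
-- 3b(b-1) ≤ 2|B'| + Σ m², and Σ m² counts pairs of ordered pairs with equal symbols. Since
-- rows and columns of L are injective, such a pair of pairs is a pair with itself, a pair with
-- its reverse (at most 2 n₂(B) of these), a chain u, v, w with L u v = L v w (counted twice),
-- or four distinct points i, j, k, l with L i j = L k l (a clash). Hence
-- b(b-1) ≤ |B'| + n₂(B) + chains(B) + clashes(B)/2. In A a chain is determined by its last two
-- points and a clash by its last three, so chains(A) ≤ (a)₂ and clashes(A) ≤ (a)₃. Averaging
-- over the b-subsets B of A, done as a greedy deletion of points, yields B with
-- chains(B) + clashes(B)/2 ≤ (b)₃/(a-2) + (b)₄/(2(a-3)), which is the claimed bound.

module Submission where

open import Defs
open import Data.Bool using (true; false; if_then_else_)
open import Data.Empty using (⊥-elim)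
open import Data.Fin using (Fin; zero; suc)
import Data.Fin as Fin
open import Data.Fin.Properties using (_≟_; any?)
import Data.Fin.Properties as Fin
open import Data.Fin.Subset using (Subset; _∈_; _∉_; _⊆_; ∣_∣; _-_)
open import Data.Fin.Subset.Properties using (_∈?_; p─q⊆p; x∈p∧x≢y⇒x∈p-y)
import Data.List as List
import Data.List.Properties as List
open import Data.Nat using (ℕ; zero; suc; _+_; _*_; _∸_; _≤_; _<_; z≤n; s≤s; z<s; _≤?_; _<?_; NonZero; >-nonZero)
open import Data.Nat.Combinatorics.Base using (_P′_)
import Data.Nat.ListAction as ListAction
open import Data.Nat.Properties hiding (_≟_; _<?_)
open import Data.Nat.Tactic.RingSolver using (solve-∀)
open import Data.Product using (_×_; _,_; ∃; proj₁; proj₂)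
open import Data.Rational as ℚ using ()
open import Data.Sum using (_⊎_; inj₁; inj₂; map₂)
open import Data.Vec using (Vec; []; _∷_; tail; here; there)
open import Data.Vec.Properties using (lookup∘tabulate; lookup⇒[]=)
open import Data.Vec.Relation.Unary.All using (All; []; _∷_)
open import Function using (_∘_)
open import Relation.Binary using (Tri; tri<; tri≈; tri>)
open import Relation.Binary.PropositionalEquality
open import Relation.Nullary using (Dec; does; yes; no; ¬_; ¬?; contradiction)
open import Relation.Nullary.Decidable using (dec-true; dec-false; _×-dec_)

open import Algebra.Properties.CommutativeSemigroup *-commutativeSemigroup
  using (x∙yz≈y∙xz; xy∙z≈zx∙y; x∙yz≈xz∙y; xy∙z≈xz∙y)
open import Algebra.Properties.Semiring.Sum +-*-semiring
  using (sum; sum-cong-≗; sum-replicate-zero; ∑-distrib-+; ∑-comm; *-distribˡ-sum; *-distribʳ-sum)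

Bit : ℕ → Set
Bit x = x ≡ 0 ⊎ x ≡ 1

Bit-* : ∀ {x y} → Bit x → Bit y → Bit (x * y)
Bit-* (inj₁ refl) _           = inj₁ refl
Bit-* (inj₂ refl) (inj₁ refl) = inj₁ refl
Bit-* (inj₂ refl) (inj₂ refl) = inj₂ refl

Bit⇒≤1 : ∀ {x} → Bit x → x ≤ 1
Bit⇒≤1 (inj₁ refl) = z≤n
Bit⇒≤1 (inj₂ refl) = ≤-refl

Bit-pos⇒≡1 : ∀ {x} → Bit x → 0 < x → x ≡ 1
Bit-pos⇒≡1 (inj₂ x≡1) _ = x≡1
Bit-pos⇒≡1 (inj₁ refl) ()

*≡1 : ∀ {a b} → a ≡ 1 → b ≡ 1 → a * b ≡ 1
*≡1 refl refl = refl

1≤+ : ∀ a {b} → a ≡ 1 ⊎ 1 ≤ b → 1 ≤ a + b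
1≤+ a (inj₁ refl) = s≤s z≤n
1≤+ a (inj₂ 1≤b)  = ≤-trans 1≤b (m≤n+m _ a)

one-summand : ∀ {a b c d e} → a ≡ 1 ⊎ b ≡ 1 ⊎ c ≡ 1 ⊎ d ≡ 1 ⊎ e ≡ 1 → 1 ≤ a + (b + (c + (d + e)))
one-summand {a} {b} {c} {d} {e} =
  1≤+ a ∘ map₂ (1≤+ b ∘ map₂ (1≤+ c ∘ map₂ (1≤+ d {e} ∘ map₂ (≤-reflexive ∘ sym))))

𝟙 : ∀ {p} {P : Set p} → Dec P → ℕ
𝟙 P? = if does P? then 1 else 0

𝟙≡1⇒ : ∀ {p} {P : Set p} (P? : Dec P) → 𝟙 P? ≡ 1 → P
𝟙≡1⇒ (yes p) _ = p

module _ {p} {P : Set p} (P? : Dec P) where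

  𝟙-Bit : Bit (𝟙 P?)
  𝟙-Bit with does P?
  ... | true  = inj₂ refl
  ... | false = inj₁ refl

  𝟙≤1 : 𝟙 P? ≤ 1
  𝟙≤1 = Bit⇒≤1 𝟙-Bit

  𝟙-yes : P → 𝟙 P? ≡ 1
  𝟙-yes p rewrite dec-true P? p = refl

  𝟙-no : ¬ P → 𝟙 P? ≡ 0
  𝟙-no ¬p rewrite dec-false P? ¬p = refl

  𝟙-pos⇒ : 0 < 𝟙 P? → P
  𝟙-pos⇒ pos = 𝟙≡1⇒ P? (Bit-pos⇒≡1 𝟙-Bit pos)

  𝟙+𝟙¬≡1 : 𝟙 P? + 𝟙 (¬? P?) ≡ 1
  𝟙+𝟙¬≡1 with does P?
  ... | true  = refl
  ... | false = refl

𝟙-cong : ∀ {p q} {P : Set p} {Q : Set q} (P? : Dec P) (Q? : Dec Q) →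
         (P → Q) → (Q → P) → 𝟙 P? ≡ 𝟙 Q?
𝟙-cong (yes p) Q? P→Q Q→P = sym (𝟙-yes Q? (P→Q p))
𝟙-cong (no ¬p) Q? P→Q Q→P = sym (𝟙-no Q? (¬p ∘ Q→P))

sum-mono-≤ : ∀ {m} {f g : Fin m → ℕ} → (∀ i → f i ≤ g i) → sum f ≤ sum g
sum-mono-≤ {zero}  _ = z≤n
sum-mono-≤ {suc m} f≤g = +-mono-≤ (f≤g zero) (sum-mono-≤ (f≤g ∘ suc))

sum-pos⇒∃ : ∀ {m} (f : Fin m → ℕ) → 0 < sum f → ∃ λ i → 0 < f i
sum-pos⇒∃ {suc m} f pos with f zero in eq
... | suc _ = zero , subst (0 <_) (sym eq) (s≤s z≤n)
... | zero with sum-pos⇒∃ (f ∘ suc) pos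
...   | i , fi>0 = suc i , fi>0

sum-map-allFin : ∀ {m} (f : Fin m → ℕ) → ListAction.sum (List.map f (List.allFin m)) ≡ sum f
sum-map-allFin {m} f = trans (cong ListAction.sum (List.map-tabulate (λ i → i) f)) (go f)
  where
  go : ∀ {k} (g : Fin k → ℕ) → ListAction.sum (List.tabulate g) ≡ sum g
  go {zero}  g = refl
  go {suc k} g = cong (g zero +_) (go (g ∘ suc))

module _ {n : ℕ} where

  δ δᶜ : Fin n → Fin n → ℕ
  δ  i j = 𝟙 (i ≟ j)
  δᶜ i j = 𝟙 (¬? (i ≟ j))

  δ-sym : ∀ i j → δ i j ≡ δ j i
  δ-sym i j with i ≟ j
  ... | yes refl = sym (𝟙-yes (i ≟ i) refl)
  ... | no  i≢j  = sym (𝟙-no (j ≟ i) (i≢j ∘ sym))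

  δᶜ-sym : ∀ i j → δᶜ i j ≡ δᶜ j i
  δᶜ-sym i j with i ≟ j
  ... | yes refl = sym (𝟙-no (¬? (i ≟ i)) (λ i≢i → i≢i refl))
  ... | no  i≢j  = sym (𝟙-yes (¬? (j ≟ i)) (i≢j ∘ sym))

  δ-≡ : ∀ {i j} → i ≡ j → δ i j ≡ 1
  δ-≡ {i} {j} = 𝟙-yes (i ≟ j)

  δ-refl : ∀ i → δ i i ≡ 1
  δ-refl i = 𝟙-yes (i ≟ i) refl

sum-δ : ∀ {m} (i : Fin m) (f : Fin m → ℕ) → sum (λ k → δ i k * f k) ≡ f i
sum-δ {suc m} zero f =
  trans (cong₂ _+_ (+-identityʳ (f zero)) (sum-replicate-zero m)) (+-identityʳ (f zero))
sum-δ (suc i) f = sum-δ i (f ∘ suc)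

sum-δʳ : ∀ {m} (i : Fin m) (f : Fin m → ℕ) → sum (λ k → δ k i * f k) ≡ f i
sum-δʳ i f = trans (sum-cong-≗ (λ k → cong (_* f k) (δ-sym k i))) (sum-δ i f)

sum-δ-const : ∀ {m} (a : Fin m) (f : Fin m → ℕ) → sum (λ k → sum (λ l → δ a k * f l)) ≡ sum f
sum-δ-const {m} a f =
  trans (sum-cong-≗ {m} (λ k → sym (*-distribˡ-sum (δ a k) f))) (sum-δ a (λ _ → sum f))

sum-δδ : ∀ {m} (a b : Fin m) x → sum (λ k → sum (λ l → δ a k * δ b l * x)) ≡ x
sum-δδ {m} a b x =
  trans (sum-cong-≗ {m} (λ k → trans (sum-cong-≗ {m} (λ l → *-assoc (δ a k) (δ b l) x))
                                     (sym (*-distribˡ-sum (δ a k) (λ l → δ b l * x)))))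
        (trans (sum-cong-≗ {m} (λ k → cong (δ a k *_) (sum-δ b (λ _ → x)))) (sum-δ a (λ _ → x)))

χ : ∀ {n} → Subset n → Fin n → ℕ
χ S i = 𝟙 (i ∈? S)

∣S∣≡sum-χ : ∀ {n} (S : Subset n) → ∣ S ∣ ≡ sum (χ S)
∣S∣≡sum-χ []          = refl
∣S∣≡sum-χ (true ∷ S)  = cong suc (∣S∣≡sum-χ S)
∣S∣≡sum-χ (false ∷ S) = ∣S∣≡sum-χ S

x∉p-x : ∀ {n} (p : Subset n) x → x ∉ p - x
x∉p-x (_ ∷ p) (suc x) (there x∈p-x) = x∉p-x p x x∈p-x

χ-remove : ∀ {n} (S : Subset n) x i → χ (S - x) i ≡ χ S i * δᶜ i x
χ-remove S x i with i ≟ x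
... | yes refl = trans (𝟙-no (i ∈? S - i) (x∉p-x S i)) (sym (*-zeroʳ (χ S i)))
... | no  i≢x  = trans (𝟙-cong (i ∈? S - x) (i ∈? S) (p─q⊆p S _) (λ i∈S → x∈p∧x≢y⇒x∈p-y i∈S i≢x))
                       (sym (*-identityʳ (χ S i)))

-- Predicates on tuples are 0/1-valued, so that counting is summation over all of Fin n ^ k.
module _ {n : ℕ} where

  ∑ᵛ : ∀ k → (Vec (Fin n) k → ℕ) → ℕ
  ∑ᵛ zero    f = f []
  ∑ᵛ (suc k) f = sum (λ x → ∑ᵛ k (λ v → f (x ∷ v)))

  ∑ᵛ-cong : ∀ k {f g : Vec (Fin n) k → ℕ} → (∀ v → f v ≡ g v) → ∑ᵛ k f ≡ ∑ᵛ k g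
  ∑ᵛ-cong zero    f≡g = f≡g []
  ∑ᵛ-cong (suc k) f≡g = sum-cong-≗ (λ x → ∑ᵛ-cong k (λ v → f≡g (x ∷ v)))

  ∑ᵛ-mono-≤ : ∀ k {f g : Vec (Fin n) k → ℕ} → (∀ v → f v ≤ g v) → ∑ᵛ k f ≤ ∑ᵛ k g
  ∑ᵛ-mono-≤ zero    f≤g = f≤g []
  ∑ᵛ-mono-≤ (suc k) f≤g = sum-mono-≤ (λ x → ∑ᵛ-mono-≤ k (λ v → f≤g (x ∷ v)))

  ∑ᵛ-distrib-+ : ∀ k (f g : Vec (Fin n) k → ℕ) →
                 ∑ᵛ k (λ v → f v + g v) ≡ ∑ᵛ k f + ∑ᵛ k g
  ∑ᵛ-distrib-+ zero    f g = refl
  ∑ᵛ-distrib-+ (suc k) f g =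
    trans (sum-cong-≗ {n} (λ x → ∑ᵛ-distrib-+ k (λ v → f (x ∷ v)) (λ v → g (x ∷ v))))
          (∑-distrib-+ (λ x → ∑ᵛ k (λ v → f (x ∷ v))) (λ x → ∑ᵛ k (λ v → g (x ∷ v))))

  *-distribˡ-∑ᵛ : ∀ k c (f : Vec (Fin n) k → ℕ) → ∑ᵛ k (λ v → c * f v) ≡ c * ∑ᵛ k f
  *-distribˡ-∑ᵛ zero    c f = refl
  *-distribˡ-∑ᵛ (suc k) c f =
    trans (sum-cong-≗ (λ x → *-distribˡ-∑ᵛ k c (λ v → f (x ∷ v))))
          (sym (*-distribˡ-sum c (λ x → ∑ᵛ k (λ v → f (x ∷ v)))))

  ∑-∑ᵛ-comm : ∀ k (f : Fin n → Vec (Fin n) k → ℕ) →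
              sum (λ x → ∑ᵛ k (f x)) ≡ ∑ᵛ k (λ v → sum (λ x → f x v))
  ∑-∑ᵛ-comm zero    f = refl
  ∑-∑ᵛ-comm (suc k) f =
    trans (∑-comm (λ x y → ∑ᵛ k (λ v → f x (y ∷ v))))
          (sum-cong-≗ (λ y → ∑-∑ᵛ-comm k (λ x v → f x (y ∷ v))))

  fresh : ∀ {k} → Vec (Fin n) k → Fin n → ℕ
  fresh []      x = 1
  fresh (p ∷ v) x = δᶜ x p * fresh v x

  distinctIn : ∀ {k} → Subset n → Vec (Fin n) k → ℕ
  distinctIn S []      = 1
  distinctIn S (p ∷ v) = distinctIn S v * (χ S p * fresh v p)

  fresh-Bit : ∀ {k} (v : Vec (Fin n) k) x → Bit (fresh v x)
  fresh-Bit []      x = inj₂ refl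
  fresh-Bit (p ∷ v) x = Bit-* (𝟙-Bit (¬? (x ≟ p))) (fresh-Bit v x)

  distinctIn-Bit : ∀ {k} S (v : Vec (Fin n) k) → Bit (distinctIn S v)
  distinctIn-Bit S []      = inj₂ refl
  distinctIn-Bit S (p ∷ v) =
    Bit-* (distinctIn-Bit S v) (Bit-* (𝟙-Bit (p ∈? S)) (fresh-Bit v p))

  distinctIn-∷ : ∀ {k} S p (v : Vec (Fin n) k) → distinctIn S (p ∷ v) ≡ 1 →
                 distinctIn S v ≡ 1 × χ S p * fresh v p ≡ 1
  distinctIn-∷ S p v d =
    m*n≡1⇒m≡1 (distinctIn S v) _ d , m*n≡1⇒n≡1 (distinctIn S v) _ d

  fresh-All : ∀ {k} (v : Vec (Fin n) k) x → All (x ≢_) v → fresh v x ≡ 1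
  fresh-All []      x []             = refl
  fresh-All (p ∷ v) x (x≢p ∷ x∉v) rewrite 𝟙-yes (¬? (x ≟ p)) x≢p | fresh-All v x x∉v = refl

  distinctIn-∷⁺ : ∀ {k} {S p} {v : Vec (Fin n) k} →
                  p ∈ S → All (p ≢_) v → distinctIn S v ≡ 1 → distinctIn S (p ∷ v) ≡ 1
  distinctIn-∷⁺ {S = S} {p} {v} p∈S p∉v d
    rewrite d | 𝟙-yes (p ∈? S) p∈S | fresh-All v p p∉v = refl

  distinctIn-pair⁻ : ∀ {S} {i j : Fin n} → distinctIn S (i ∷ j ∷ []) ≡ 1 → i ∈ S × j ∈ S × i ≢ j
  distinctIn-pair⁻ {S} {i} {j} d with distinctIn-∷ S i (j ∷ []) d
  ... | dj , χi*fi≡1 =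
    𝟙≡1⇒ (i ∈? S) (m*n≡1⇒m≡1 (χ S i) _ χi*fi≡1) ,
    𝟙≡1⇒ (j ∈? S) (m*n≡1⇒m≡1 (χ S j) 1 (proj₂ (distinctIn-∷ S j [] dj))) ,
    𝟙≡1⇒ (¬? (i ≟ j)) (m*n≡1⇒m≡1 (δᶜ i j) 1 (m*n≡1⇒n≡1 (χ S i) _ χi*fi≡1))

  sum-fresh : ∀ {k} S (v : Vec (Fin n) k) → distinctIn S v ≡ 1 →
              sum (λ x → χ S x * fresh v x) + k ≡ ∣ S ∣
  sum-fresh S [] _ =
    trans (+-identityʳ _) (trans (sum-cong-≗ {n} (λ x → *-identityʳ (χ S x))) (sym (∣S∣≡sum-χ S)))
  sum-fresh {suc k} S (p ∷ v) d = begin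
      sum (λ x → χ S x * (δᶜ x p * fresh v x)) + suc k
    ≡⟨ trans (+-suc _ k) (cong (_+ k) (+-comm 1 _)) ⟩
      sum (λ x → χ S x * (δᶜ x p * fresh v x)) + 1 + k
    ≡⟨ cong (λ t → sum (λ x → χ S x * (δᶜ x p * fresh v x)) + t + k) p-term ⟨
      sum (λ x → χ S x * (δᶜ x p * fresh v x)) + sum (λ x → δ x p * (χ S x * fresh v x)) + k
    ≡⟨ cong (_+ k) (∑-distrib-+ (λ x → χ S x * (δᶜ x p * fresh v x)) (λ x → δ x p * (χ S x * fresh v x))) ⟨
      sum (λ x → χ S x * (δᶜ x p * fresh v x) + δ x p * (χ S x * fresh v x)) + k
    ≡⟨ cong (_+ k) (sum-cong-≗ {n} split) ⟩
      sum (λ x → χ S x * fresh v x) + k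
    ≡⟨ sum-fresh S v (proj₁ (distinctIn-∷ S p v d)) ⟩
      ∣ S ∣ ∎
    where
    open ≡-Reasoning
    p-term : sum (λ x → δ x p * (χ S x * fresh v x)) ≡ 1
    p-term = trans (sum-δʳ p (λ x → χ S x * fresh v x)) (proj₂ (distinctIn-∷ S p v d))
    split : ∀ x → χ S x * (δᶜ x p * fresh v x) + δ x p * (χ S x * fresh v x) ≡ χ S x * fresh v x
    split x = trans (rearrange (χ S x) (fresh v x) (δ x p) (δᶜ x p))
                    (trans (cong (_* (χ S x * fresh v x)) (𝟙+𝟙¬≡1 (x ≟ p))) (*-identityˡ _))
      where
      rearrange : ∀ a b c d → a * (d * b) + c * (a * b) ≡ (c + d) * (a * b)
      rearrange = solve-∀

  ∣S-x∣+1≡∣S∣ : ∀ S x → x ∈ S → ∣ S - x ∣ + 1 ≡ ∣ S ∣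
  ∣S-x∣+1≡∣S∣ S x x∈S = begin
      ∣ S - x ∣ + 1
    ≡⟨ cong (_+ 1) (∣S∣≡sum-χ (S - x)) ⟩
      sum (χ (S - x)) + 1
    ≡⟨ cong (_+ 1) (sum-cong-≗ {n} (λ i → trans (χ-remove S x i) (cong (χ S i *_) (sym (*-identityʳ (δᶜ i x)))))) ⟩
      sum (λ i → χ S i * fresh (x ∷ []) i) + 1
    ≡⟨ sum-fresh S (x ∷ []) (trans (+-identityʳ _) (trans (*-identityʳ (χ S x)) (𝟙-yes (x ∈? S) x∈S))) ⟩
      ∣ S ∣ ∎
    where open ≡-Reasoning

  tupleSum : ∀ k → (Vec (Fin n) k → ℕ) → Subset n → ℕ
  tupleSum k g S = ∑ᵛ k (λ v → distinctIn S v * g v)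

  tupleSum-extend : ∀ k S (g : Vec (Fin n) k → ℕ) →
    sum (λ x → ∑ᵛ k (λ v → distinctIn S v * g v * (χ S x * fresh v x))) ≡ (∣ S ∣ ∸ k) * tupleSum k g S
  tupleSum-extend k S g = begin
      sum (λ x → ∑ᵛ k (λ v → distinctIn S v * g v * (χ S x * fresh v x)))
    ≡⟨ ∑-∑ᵛ-comm k (λ x v → distinctIn S v * g v * (χ S x * fresh v x)) ⟩
      ∑ᵛ k (λ v → sum (λ x → distinctIn S v * g v * (χ S x * fresh v x)))
    ≡⟨ ∑ᵛ-cong k extend ⟩
      ∑ᵛ k (λ v → (∣ S ∣ ∸ k) * (distinctIn S v * g v))
    ≡⟨ *-distribˡ-∑ᵛ k (∣ S ∣ ∸ k) (λ v → distinctIn S v * g v) ⟩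
      (∣ S ∣ ∸ k) * tupleSum k g S ∎
    where
    open ≡-Reasoning
    extend : ∀ v → sum (λ x → distinctIn S v * g v * (χ S x * fresh v x)) ≡ (∣ S ∣ ∸ k) * (distinctIn S v * g v)
    extend v with distinctIn-Bit S v
    ... | inj₁ d≡0 rewrite d≡0 = trans (sum-replicate-zero n) (sym (*-zeroʳ (∣ S ∣ ∸ k)))
    ... | inj₂ d≡1 = begin
        sum (λ x → distinctIn S v * g v * (χ S x * fresh v x))
      ≡⟨ *-distribˡ-sum (distinctIn S v * g v) (λ x → χ S x * fresh v x) ⟨
        distinctIn S v * g v * sum (λ x → χ S x * fresh v x)
      ≡⟨ cong (distinctIn S v * g v *_) (trans (sym (m+n∸n≡m _ k)) (cong (_∸ k) (sum-fresh S v d≡1))) ⟩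
        distinctIn S v * g v * (∣ S ∣ ∸ k)
      ≡⟨ *-comm _ (∣ S ∣ ∸ k) ⟩
        (∣ S ∣ ∸ k) * (distinctIn S v * g v) ∎

  -- n P′ k = n (n-1) ⋯ (n-k+1) for every k, in particular 0 when k > n.
  ∑ᵛ-distinctIn : ∀ k S → ∑ᵛ k (distinctIn S) ≡ ∣ S ∣ P′ k
  ∑ᵛ-distinctIn zero    S = refl
  ∑ᵛ-distinctIn (suc k) S = begin
      ∑ᵛ (suc k) (distinctIn S)
    ≡⟨ sum-cong-≗ {n} (λ x → ∑ᵛ-cong k (λ v → cong (_* (χ S x * fresh v x)) (*-identityʳ (distinctIn S v)))) ⟨
      sum (λ x → ∑ᵛ k (λ v → distinctIn S v * 1 * (χ S x * fresh v x)))
    ≡⟨ tupleSum-extend k S (λ _ → 1) ⟩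
      (∣ S ∣ ∸ k) * tupleSum k (λ _ → 1) S
    ≡⟨ cong ((∣ S ∣ ∸ k) *_) (∑ᵛ-cong k (λ v → *-identityʳ (distinctIn S v))) ⟩
      (∣ S ∣ ∸ k) * ∑ᵛ k (distinctIn S)
    ≡⟨ cong ((∣ S ∣ ∸ k) *_) (∑ᵛ-distinctIn k S) ⟩
      (∣ S ∣ ∸ k) * (∣ S ∣ P′ k) ∎
    where open ≡-Reasoning

  tupleSum-lift : ∀ k (g : Vec (Fin n) k → ℕ) S →
                  tupleSum (suc k) (g ∘ tail) S ≡ (∣ S ∣ ∸ k) * tupleSum k g S
  tupleSum-lift k g S =
    trans (sum-cong-≗ {n} (λ x → ∑ᵛ-cong k (λ v → xy∙z≈xz∙y (distinctIn S v) (χ S x * fresh v x) (g v))))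
          (tupleSum-extend k S g)

  tupleSum≤P′ : ∀ k (g : Vec (Fin n) k → ℕ) S → (∀ v → g v ≤ 1) → tupleSum k g S ≤ ∣ S ∣ P′ k
  tupleSum≤P′ k g S g≤1 =
    subst (tupleSum k g S ≤_) (∑ᵛ-distinctIn k S)
          (∑ᵛ-mono-≤ k (λ v → subst (distinctIn S v * g v ≤_) (*-identityʳ (distinctIn S v))
                                    (*-monoʳ-≤ (distinctIn S v) (g≤1 v))))

  tupleSum≤P′-tail : ∀ k (g : Vec (Fin n) (suc k) → ℕ) S → (∀ v → sum (λ u → g (u ∷ v)) ≤ 1) →
                     tupleSum (suc k) g S ≤ ∣ S ∣ P′ k
  tupleSum≤P′-tail k g S unique-head = begin
      sum (λ u → ∑ᵛ k (λ v → distinctIn S (u ∷ v) * g (u ∷ v)))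
    ≤⟨ sum-mono-≤ (λ u → ∑ᵛ-mono-≤ k (λ v → *-monoˡ-≤ (g (u ∷ v)) (distinctIn-∷≤ u v))) ⟩
      sum (λ u → ∑ᵛ k (λ v → distinctIn S v * g (u ∷ v)))
    ≡⟨ ∑-∑ᵛ-comm k (λ u v → distinctIn S v * g (u ∷ v)) ⟩
      ∑ᵛ k (λ v → sum (λ u → distinctIn S v * g (u ∷ v)))
    ≡⟨ ∑ᵛ-cong k (λ v → sym (*-distribˡ-sum (distinctIn S v) (λ u → g (u ∷ v)))) ⟩
      ∑ᵛ k (λ v → distinctIn S v * sum (λ u → g (u ∷ v)))
    ≤⟨ ∑ᵛ-mono-≤ k (λ v → subst (distinctIn S v * sum (λ u → g (u ∷ v)) ≤_) (*-identityʳ (distinctIn S v))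
                                 (*-monoʳ-≤ (distinctIn S v) (unique-head v))) ⟩
      ∑ᵛ k (distinctIn S)
    ≡⟨ ∑ᵛ-distinctIn k S ⟩
      ∣ S ∣ P′ k ∎
    where
    open ≤-Reasoning
    distinctIn-∷≤ : ∀ {k} u (v : Vec (Fin n) k) → distinctIn S (u ∷ v) ≤ distinctIn S v
    distinctIn-∷≤ u v = subst (distinctIn S (u ∷ v) ≤_) (*-identityʳ (distinctIn S v))
      (*-monoʳ-≤ (distinctIn S v) (Bit⇒≤1 (Bit-* (𝟙-Bit (u ∈? S)) (fresh-Bit v u))))

  distinctIn-remove : ∀ {k} S x (v : Vec (Fin n) k) → distinctIn (S - x) v ≡ distinctIn S v * fresh v x
  distinctIn-remove S x []      = refl
  distinctIn-remove S x (p ∷ v)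
    rewrite distinctIn-remove S x v | χ-remove S x p | δᶜ-sym p x =
    rearrange (distinctIn S v) (fresh v x) (χ S p) (δᶜ x p) (fresh v p)
    where
    rearrange : ∀ a b c d f → a * b * (c * d * f) ≡ a * (c * f) * (d * b)
    rearrange = solve-∀

  tupleSum-remove : ∀ k g S → sum (λ x → χ S x * tupleSum k g (S - x)) ≡ (∣ S ∣ ∸ k) * tupleSum k g S
  tupleSum-remove k g S =
    trans (sum-cong-≗ {n} (λ x → trans (sym (*-distribˡ-∑ᵛ k (χ S x) _)) (∑ᵛ-cong k (reorder x))))
          (tupleSum-extend k S g)
    where
    reorder : ∀ x v → χ S x * (distinctIn (S - x) v * g v) ≡ distinctIn S v * g v * (χ S x * fresh v x)
    reorder x v rewrite distinctIn-remove S x v = rearrange (χ S x) (distinctIn S v) (fresh v x) (g v)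
      where
      rearrange : ∀ a b c d → a * (b * c * d) ≡ b * d * (a * c)
      rearrange = solve-∀

[1+n]P′[1+k]≡[1+n]*nP′k : ∀ n k → suc n P′ suc k ≡ suc n * (n P′ k)
[1+n]P′[1+k]≡[1+n]*nP′k n zero    = refl
[1+n]P′[1+k]≡[1+n]*nP′k n (suc k) =
  trans (cong ((n ∸ k) *_) ([1+n]P′[1+k]≡[1+n]*nP′k n k)) (x∙yz≈y∙xz (n ∸ k) (suc n) (n P′ k))

∃-below-average : ∀ {m} (w f : Fin m → ℕ) M →
                  sum (λ x → w x * f x) ≤ sum w * M → 0 < sum w →
                  ∃ λ x → 0 < w x × f x ≤ M
∃-below-average w f M avg≤M pos with any? (λ x → (0 <? w x) ×-dec (f x ≤? M))
... | yes witness = witness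
... | no  none    = contradiction avg≤M (<⇒≱ (begin-strict
    sum w * M                 <⟨ m<m+n (sum w * M) pos ⟩
    sum w * M + sum w         ≡⟨ +-comm _ (sum w) ⟩
    sum w + sum w * M         ≡⟨ *-suc (sum w) M ⟨
    sum w * suc M             ≡⟨ *-distribʳ-sum (suc M) w ⟩
    sum (λ x → w x * suc M)   ≤⟨ sum-mono-≤ above ⟩
    sum (λ x → w x * f x)     ∎))
  where
  open ≤-Reasoning
  above : ∀ x → w x * suc M ≤ w x * f x
  above x with w x in eq
  ... | zero  = z≤n
  ... | suc k = *-monoʳ-≤ (suc k) (≰⇒> (λ fx≤M → none (x , subst (0 <_) (sym eq) (s≤s z≤n) , fx≤M)))

shrink-bound : ∀ k b s {p q r} → k ≤ s →
               (s P′ k) * p ≤ (b P′ k) * q → suc s * q ≤ (suc s ∸ k) * r →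
               (suc s P′ k) * p ≤ (b P′ k) * r
shrink-bound k b s {p} {q} {r} k≤s ih choice = *-cancelʳ-≤ _ _ c (begin
    (suc s P′ k) * p * c          ≡⟨ xy∙z≈zx∙y (suc s P′ k) p c ⟩
    c * (suc s P′ k) * p          ≡⟨ cong (_* p) ([1+n]P′[1+k]≡[1+n]*nP′k s k) ⟩
    suc s * (s P′ k) * p          ≡⟨ *-assoc (suc s) (s P′ k) p ⟩
    suc s * ((s P′ k) * p)        ≤⟨ *-monoʳ-≤ (suc s) ih ⟩
    suc s * ((b P′ k) * q)        ≡⟨ x∙yz≈y∙xz (suc s) (b P′ k) q ⟩
    (b P′ k) * (suc s * q)        ≤⟨ *-monoʳ-≤ (b P′ k) choice ⟩
    (b P′ k) * (c * r)            ≡⟨ x∙yz≈xz∙y (b P′ k) c r ⟩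
    (b P′ k) * r * c              ∎)
  where
  open ≤-Reasoning
  c = suc s ∸ k
  instance
    c≢0 : NonZero c
    c≢0 = >-nonZero (m<n⇒0<n∸m (s≤s k≤s))

-- The hypothesis says that deleting a point of S keeps P at (|S| - k)/|S| · P S on average, as for
-- a sum over k-tuples; deleting a point below the average |S| - b times gives (a)ₖ P B ≤ (b)ₖ P S.
module Averaging {n : ℕ} (k : ℕ) (P : Subset n → ℕ)
  (P-remove : ∀ S → sum (λ x → χ S x * P (S - x)) ≤ (∣ S ∣ ∸ k) * P S) where

  remove-one : ∀ S → 0 < ∣ S ∣ → ∃ λ x → x ∈ S × ∣ S ∣ * P (S - x) ≤ (∣ S ∣ ∸ k) * P S
  remove-one S pos
    with ∃-below-average (χ S) (λ x → ∣ S ∣ * P (S - x)) ((∣ S ∣ ∸ k) * P S)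
                         average (subst (0 <_) (∣S∣≡sum-χ S) pos)
    where
    average : sum (λ x → χ S x * (∣ S ∣ * P (S - x))) ≤ sum (χ S) * ((∣ S ∣ ∸ k) * P S)
    average = begin
      sum (λ x → χ S x * (∣ S ∣ * P (S - x)))   ≡⟨ sum-cong-≗ {n} (λ x → x∙yz≈y∙xz (χ S x) ∣ S ∣ (P (S - x))) ⟩
      sum (λ x → ∣ S ∣ * (χ S x * P (S - x)))   ≡⟨ *-distribˡ-sum ∣ S ∣ (λ x → χ S x * P (S - x)) ⟨
      ∣ S ∣ * sum (λ x → χ S x * P (S - x))     ≤⟨ *-monoʳ-≤ ∣ S ∣ (P-remove S) ⟩
      ∣ S ∣ * ((∣ S ∣ ∸ k) * P S)               ≡⟨ cong (_* ((∣ S ∣ ∸ k) * P S)) (∣S∣≡sum-χ S) ⟩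
      sum (χ S) * ((∣ S ∣ ∸ k) * P S)           ∎
      where
      open ≤-Reasoning
  ... | x , χSx>0 , below = x , 𝟙-pos⇒ (x ∈? S) χSx>0 , below

  shrink : ∀ {b} → k ≤ b → ∀ d S → ∣ S ∣ ≡ d + b →
              ∃ λ B → B ⊆ S × ∣ B ∣ ≡ b × ((d + b) P′ k) * P B ≤ (b P′ k) * P S
  shrink k≤b zero S ∣S∣≡b = S , (λ x∈S → x∈S) , ∣S∣≡b , ≤-refl
  shrink {b} k≤b (suc d) S ∣S∣≡1+d+b
    with remove-one S (subst (0 <_) (sym ∣S∣≡1+d+b) z<s)
  ... | x , x∈S , below
    with shrink k≤b d (S - x) (suc-injective (trans (+-comm 1 _) (trans (∣S-x∣+1≡∣S∣ S x x∈S) ∣S∣≡1+d+b)))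
  ...   | B , B⊆S-x , ∣B∣≡b , bound-S-x =
    B , p─q⊆p S _ ∘ B⊆S-x , ∣B∣≡b ,
    shrink-bound k b (d + b) (≤-trans k≤b (m≤n+m b d)) bound-S-x
                 (subst (λ s → s * P (S - x) ≤ (s ∸ k) * P S) ∣S∣≡1+d+b below)

  averaging : ∀ {a b} → k ≤ b → b ≤ a → ∀ S → ∣ S ∣ ≡ a →
              ∃ λ B → B ⊆ S × ∣ B ∣ ≡ b × (a P′ k) * P B ≤ (b P′ k) * P S
  averaging {a} {b} k≤b b≤a S ∣S∣≡a with shrink k≤b (a ∸ b) S (trans ∣S∣≡a (sym (m∸n+n≡m b≤a)))
  ... | B , B⊆S , ∣B∣≡b , bound =
    B , B⊆S , ∣B∣≡b , subst (λ m → (m P′ k) * P B ≤ (b P′ k) * P S) (m∸n+n≡m b≤a) bound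

module LatinCounts {n : ℕ} (L : LatinSquare n) (isL : IsLatinSquare L) where

  row-injective : ∀ i {j l} → L i j ≡ L i l → j ≡ l
  row-injective i = proj₁ (proj₁ isL i)

  col-injective : ∀ j {i k} → L i j ≡ L k j → i ≡ k
  col-injective j = proj₁ (proj₂ isL j)

  chain : Vec (Fin n) 3 → ℕ
  chain (u ∷ v ∷ w ∷ []) = δ (L u v) (L v w)

  clash : Vec (Fin n) 4 → ℕ
  clash (i ∷ j ∷ k ∷ l ∷ []) = δ (L i j) (L k l)

  chains clashes excess : Subset n → ℕ
  chains  = tupleSum 3 chain
  clashes = tupleSum 4 clash
  excess B = 2 * chains B + clashes B

  column-sum : ∀ j y → sum (λ u → δ (L u j) y) ≡ 1
  column-sum j y with proj₂ (proj₂ isL j) y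
  ... | u₀ , Lu₀j≡y =
    trans (sum-cong-≗ {n} λ u → trans (hits u) (sym (*-identityʳ (δ u₀ u)))) (sum-δ u₀ (λ _ → 1))
    where
    hits : ∀ u → δ (L u j) y ≡ δ u₀ u
    hits u = 𝟙-cong (L u j ≟ y) (u₀ ≟ u) (λ Luj≡y → col-injective j (trans (Lu₀j≡y refl) (sym Luj≡y)))
                                         (λ u₀≡u → Lu₀j≡y (sym u₀≡u))

  chains≤P′2 : ∀ S → chains S ≤ ∣ S ∣ P′ 2
  chains≤P′2 S = tupleSum≤P′-tail 2 chain S λ { (v ∷ w ∷ []) → ≤-reflexive (column-sum v (L v w)) }

  clashes≤P′3 : ∀ S → clashes S ≤ ∣ S ∣ P′ 3
  clashes≤P′3 S = tupleSum≤P′-tail 3 clash S λ { (j ∷ k ∷ l ∷ []) → ≤-reflexive (column-sum j (L k l)) }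

  chains≤P′3 : ∀ S → chains S ≤ ∣ S ∣ P′ 3
  chains≤P′3 S = tupleSum≤P′ 3 chain S λ { (u ∷ v ∷ w ∷ []) → 𝟙≤1 (L u v ≟ L v w) }

  clashes≤P′4 : ∀ S → clashes S ≤ ∣ S ∣ P′ 4
  clashes≤P′4 S = tupleSum≤P′ 4 clash S λ { (i ∷ j ∷ k ∷ l ∷ []) → 𝟙≤1 (L i j ≟ L k l) }

  module _ (B : Subset n) where

    pairIn : Fin n → Fin n → ℕ
    pairIn i j = distinctIn B (i ∷ j ∷ [])

    chainIn : Fin n → Fin n → Fin n → ℕ
    chainIn u v w = distinctIn B (u ∷ v ∷ w ∷ []) * chain (u ∷ v ∷ w ∷ [])

    mult : Fin n → ℕ
    mult x = sum λ i → sum λ j → pairIn i j * δ (L i j) x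

    symmetric : ℕ
    symmetric = sum λ i → sum λ j → pairIn i j * δ (L i j) (L j i)

    collisions samePair reversedPair chainAfter chainBefore fourClash collisionTerms : Vec (Fin n) 4 → ℕ
    collisions   (i ∷ j ∷ k ∷ l ∷ []) = pairIn i j * pairIn k l * δ (L i j) (L k l)
    samePair     (i ∷ j ∷ k ∷ l ∷ []) = δ i k * δ j l * pairIn i j
    reversedPair (i ∷ j ∷ k ∷ l ∷ []) = δ j k * δ i l * (pairIn i j * δ (L i j) (L j i))
    chainAfter   (i ∷ j ∷ k ∷ l ∷ []) = δ j k * chainIn i j l
    chainBefore  (i ∷ j ∷ k ∷ l ∷ []) = δ i l * chainIn k i j
    fourClash v = distinctIn B v * clash v
    collisionTerms v = samePair v + (reversedPair v + (chainAfter v + (chainBefore v + fourClash v)))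

    pairIn⁺ : ∀ {i j} → i ∈ B → j ∈ B → i ≢ j → pairIn i j ≡ 1
    pairIn⁺ i∈B j∈B i≢j = distinctIn-∷⁺ i∈B (i≢j ∷ []) (distinctIn-∷⁺ j∈B [] refl)

    -- Row injectivity turns i = k into j = l, and column injectivity excludes j = l with i ≠ k.
    collision-cases : ∀ i j k l → Dec (i ≡ k) → Dec (j ≡ l) → Dec (j ≡ k) → Dec (i ≡ l) →
      i ∈ B × j ∈ B × i ≢ j → k ∈ B × l ∈ B × k ≢ l → L i j ≡ L k l →
      let v = i ∷ j ∷ k ∷ l ∷ [] in
      samePair v ≡ 1 ⊎ reversedPair v ≡ 1 ⊎ chainAfter v ≡ 1 ⊎ chainBefore v ≡ 1 ⊎ fourClash v ≡ 1
    collision-cases i j .i l (yes refl) _ _ _ (i∈B , j∈B , i≢j) _ Lij≡Lil =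
      inj₁ (*≡1 (*≡1 (δ-refl i) (δ-≡ (row-injective i Lij≡Lil))) (pairIn⁺ i∈B j∈B i≢j))
    collision-cases i j k .j (no i≢k) (yes refl) _ _ _ _ Lij≡Lkj =
      ⊥-elim (i≢k (col-injective j Lij≡Lkj))
    collision-cases i j .j .i (no _) (no _) (yes refl) (yes refl) (i∈B , j∈B , i≢j) _ Lij≡Lji =
      inj₂ (inj₁ (*≡1 (*≡1 (δ-refl j) (δ-refl i)) (*≡1 (pairIn⁺ i∈B j∈B i≢j) (δ-≡ Lij≡Lji))))
    collision-cases i j .j l (no _) (no _) (yes refl) (no i≢l) (i∈B , j∈B , i≢j) (_ , l∈B , j≢l) Lij≡Ljl =
      inj₂ (inj₂ (inj₁ (*≡1 (δ-refl j) (*≡1 distinct (δ-≡ Lij≡Ljl)))))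
      where
      distinct = distinctIn-∷⁺ i∈B (i≢j ∷ i≢l ∷ []) (pairIn⁺ j∈B l∈B j≢l)
    collision-cases i j k .i (no _) (no _) (no j≢k) (yes refl) (i∈B , j∈B , i≢j) (k∈B , _ , k≢i) Lij≡Lki =
      inj₂ (inj₂ (inj₂ (inj₁ (*≡1 (δ-refl i) (*≡1 distinct (δ-≡ (sym Lij≡Lki)))))))
      where
      distinct = distinctIn-∷⁺ k∈B (k≢i ∷ (j≢k ∘ sym) ∷ []) (pairIn⁺ i∈B j∈B i≢j)
    collision-cases i j k l (no i≢k) (no j≢l) (no j≢k) (no i≢l) (i∈B , j∈B , i≢j) (k∈B , l∈B , k≢l) Lij≡Lkl =
      inj₂ (inj₂ (inj₂ (inj₂ (*≡1 distinct (δ-≡ Lij≡Lkl)))))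
      where
      distinct = distinctIn-∷⁺ i∈B (i≢j ∷ i≢k ∷ i≢l ∷ [])
                   (distinctIn-∷⁺ j∈B (j≢k ∷ j≢l ∷ []) (pairIn⁺ k∈B l∈B k≢l))

    collision≤ : ∀ v → collisions v ≤ collisionTerms v
    collision≤ (i ∷ j ∷ k ∷ l ∷ [])
      with Bit-* (Bit-* (distinctIn-Bit B (i ∷ j ∷ [])) (distinctIn-Bit B (k ∷ l ∷ []))) (𝟙-Bit (L i j ≟ L k l))
    ... | inj₁ c≡0 = ≤-trans (≤-reflexive c≡0) z≤n
    ... | inj₂ c≡1 = ≤-trans (≤-reflexive c≡1) (one-summand
      (collision-cases i j k l (i ≟ k) (j ≟ l) (j ≟ k) (i ≟ l)
                       (distinctIn-pair⁻ pij) (distinctIn-pair⁻ pkl) (𝟙≡1⇒ (L i j ≟ L k l) Lij≐Lkl)))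
      where
      pij×pkl = m*n≡1⇒m≡1 (pairIn i j * pairIn k l) _ c≡1
      Lij≐Lkl = m*n≡1⇒n≡1 (pairIn i j * pairIn k l) _ c≡1
      pij = m*n≡1⇒m≡1 (pairIn i j) _ pij×pkl
      pkl = m*n≡1⇒n≡1 (pairIn i j) _ pij×pkl

    sum-mult² : sum (λ x → mult x * mult x) ≡ ∑ᵛ 4 collisions
    sum-mult² = begin
        sum (λ x → mult x * mult x)
      ≡⟨ sum-cong-≗ {n} expand ⟩
        sum (λ x → ∑ᵛ 4 (both x))
      ≡⟨ ∑-∑ᵛ-comm 4 both ⟩
        ∑ᵛ 4 (λ v → sum (λ x → both x v))
      ≡⟨ ∑ᵛ-cong 4 same-symbol ⟩
        ∑ᵛ 4 collisions ∎
      where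
      open ≡-Reasoning
      both : Fin n → Vec (Fin n) 4 → ℕ
      both x (i ∷ j ∷ k ∷ l ∷ []) = pairIn i j * δ (L i j) x * (pairIn k l * δ (L k l) x)
      expand : ∀ x → mult x * mult x ≡ ∑ᵛ 4 (both x)
      expand x =
        trans (*-distribʳ-sum (mult x) (λ i → sum λ j → pairIn i j * δ (L i j) x)) (sum-cong-≗ {n} λ i →
        trans (*-distribʳ-sum (mult x) (λ j → pairIn i j * δ (L i j) x)) (sum-cong-≗ {n} λ j →
        trans (*-distribˡ-sum (pairIn i j * δ (L i j) x) (λ k → sum λ l → pairIn k l * δ (L k l) x))
              (sum-cong-≗ {n} λ k →
        *-distribˡ-sum (pairIn i j * δ (L i j) x) (λ l → pairIn k l * δ (L k l) x))))
      same-symbol : ∀ v → sum (λ x → both x v) ≡ collisions v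
      same-symbol (i ∷ j ∷ k ∷ l ∷ []) = begin
          sum (λ x → pairIn i j * δ (L i j) x * (pairIn k l * δ (L k l) x))
        ≡⟨ sum-cong-≗ {n} (λ x → rearrange (pairIn i j) (δ (L i j) x) (pairIn k l) (δ (L k l) x)) ⟩
          sum (λ x → δ (L i j) x * (pairIn i j * pairIn k l * δ (L k l) x))
        ≡⟨ sum-δ (L i j) (λ x → pairIn i j * pairIn k l * δ (L k l) x) ⟩
          pairIn i j * pairIn k l * δ (L k l) (L i j)
        ≡⟨ cong (pairIn i j * pairIn k l *_) (δ-sym (L k l) (L i j)) ⟩
          collisions (i ∷ j ∷ k ∷ l ∷ []) ∎
        where
        rearrange : ∀ a b c d → a * b * (c * d) ≡ b * (a * c * d)
        rearrange = solve-∀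

    ∑ᵛ-collisionTerms : ∑ᵛ 4 collisionTerms ≡ ∣ B ∣ P′ 2 + (symmetric + (chains B + (chains B + clashes B)))
    ∑ᵛ-collisionTerms = begin
        ∑ᵛ 4 collisionTerms
      ≡⟨ ∑ᵛ-distrib-+ 4 samePair (λ v → reversedPair v + (chainAfter v + (chainBefore v + fourClash v))) ⟩
        ∑ᵛ 4 samePair + ∑ᵛ 4 (λ v → reversedPair v + (chainAfter v + (chainBefore v + fourClash v)))
      ≡⟨ cong (∑ᵛ 4 samePair +_) (∑ᵛ-distrib-+ 4 reversedPair (λ v → chainAfter v + (chainBefore v + fourClash v))) ⟩
        ∑ᵛ 4 samePair + (∑ᵛ 4 reversedPair + ∑ᵛ 4 (λ v → chainAfter v + (chainBefore v + fourClash v)))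
      ≡⟨ cong (λ t → ∑ᵛ 4 samePair + (∑ᵛ 4 reversedPair + t))
              (trans (∑ᵛ-distrib-+ 4 chainAfter (λ v → chainBefore v + fourClash v))
                     (cong (∑ᵛ 4 chainAfter +_) (∑ᵛ-distrib-+ 4 chainBefore fourClash))) ⟩
        ∑ᵛ 4 samePair + (∑ᵛ 4 reversedPair + (∑ᵛ 4 chainAfter + (∑ᵛ 4 chainBefore + clashes B)))
      ≡⟨ cong₂ (λ s r → s + (r + (∑ᵛ 4 chainAfter + (∑ᵛ 4 chainBefore + clashes B)))) same reversed ⟩
        ∣ B ∣ P′ 2 + (symmetric + (∑ᵛ 4 chainAfter + (∑ᵛ 4 chainBefore + clashes B)))
      ≡⟨ cong₂ (λ a b → ∣ B ∣ P′ 2 + (symmetric + (a + (b + clashes B)))) after before ⟩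
        ∣ B ∣ P′ 2 + (symmetric + (chains B + (chains B + clashes B))) ∎
      where
      open ≡-Reasoning
      same : ∑ᵛ 4 samePair ≡ ∣ B ∣ P′ 2
      same = trans (sum-cong-≗ {n} λ i → sum-cong-≗ {n} λ j → sum-δδ i j (pairIn i j)) (∑ᵛ-distinctIn 2 B)
      reversed : ∑ᵛ 4 reversedPair ≡ symmetric
      reversed = sum-cong-≗ {n} λ i → sum-cong-≗ {n} λ j → sum-δδ j i (pairIn i j * δ (L i j) (L j i))
      after : ∑ᵛ 4 chainAfter ≡ chains B
      after = sum-cong-≗ {n} λ i → sum-cong-≗ {n} λ j → sum-δ-const j (chainIn i j)
      before : ∑ᵛ 4 chainBefore ≡ chains B
      before = begin
          sum (λ i → sum λ j → sum λ k → sum λ l → δ i l * chainIn k i j)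
        ≡⟨ (sum-cong-≗ {n} λ i → sum-cong-≗ {n} λ j → sum-cong-≗ {n} λ k → sum-δ i (λ _ → chainIn k i j)) ⟩
          sum (λ i → sum λ j → sum λ k → chainIn k i j)
        ≡⟨ sum-cong-≗ {n} (λ i → ∑-comm (λ j k → chainIn k i j)) ⟩
          sum (λ i → sum λ k → sum λ j → chainIn k i j)
        ≡⟨ ∑-comm (λ i k → sum λ j → chainIn k i j) ⟩
          chains B ∎

    sum-mult : sum mult ≡ ∣ B ∣ P′ 2
    sum-mult = begin
        sum (λ x → sum λ i → sum λ j → pairIn i j * δ (L i j) x)
      ≡⟨ ∑-comm (λ x i → sum λ j → pairIn i j * δ (L i j) x) ⟩
        sum (λ i → sum λ x → sum λ j → pairIn i j * δ (L i j) x)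
      ≡⟨ (sum-cong-≗ {n} λ i → ∑-comm (λ x j → pairIn i j * δ (L i j) x)) ⟩
        sum (λ i → sum λ j → sum λ x → pairIn i j * δ (L i j) x)
      ≡⟨ (sum-cong-≗ {n} λ i → sum-cong-≗ {n} λ j → one-symbol (pairIn i j) (L i j)) ⟩
        ∑ᵛ 2 (distinctIn B)
      ≡⟨ ∑ᵛ-distinctIn 2 B ⟩
        ∣ B ∣ P′ 2 ∎
      where
      open ≡-Reasoning
      one-symbol : ∀ c y → sum (λ x → c * δ y x) ≡ c
      one-symbol c y = trans (sum-cong-≗ {n} (λ x → *-comm c (δ y x))) (sum-δ y (λ _ → c))

    mult-pos⇒∈prime : ∀ x → 0 < mult x → x ∈ prime L B
    mult-pos⇒∈prime x pos with sum-pos⇒∃ (λ i → sum λ j → pairIn i j * δ (L i j) x) pos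
    ... | i , pos-i with sum-pos⇒∃ (λ j → pairIn i j * δ (L i j) x) pos-i
    ...   | j , pos-ij = lookup⇒[]= x (prime L B) (trans (lookup∘tabulate _ x) (dec-true
            (any? λ i → any? λ j → (i ∈? B) ×-dec (j ∈? B) ×-dec ¬? (i ≟ j) ×-dec (L i j ≟ x))
            (i , j , i∈B , j∈B , i≢j , 𝟙≡1⇒ (L i j ≟ x) (m*n≡1⇒n≡1 (pairIn i j) _ pij×δ≡1))))
      where
      pij×δ≡1 = Bit-pos⇒≡1 (Bit-* (distinctIn-Bit B (i ∷ j ∷ [])) (𝟙-Bit (L i j ≟ x))) pos-ij
      facts = distinctIn-pair⁻ (m*n≡1⇒m≡1 (pairIn i j) _ pij×δ≡1)
      i∈B = proj₁ facts
      j∈B = proj₁ (proj₂ facts)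
      i≢j = proj₂ (proj₂ facts)

    -- (m-1)(m-2) ≥ 0, and m > 0 puts x in B'.
    3*mult≤ : ∀ x → 3 * mult x ≤ 2 * χ (prime L B) x + mult x * mult x
    3*mult≤ x with mult x in eq
    ... | zero  = z≤n
    ... | suc m rewrite 𝟙-yes (x ∈? prime L B) (mult-pos⇒∈prime x (subst (0 <_) (sym eq) z<s)) =
      3m≤2+m² (suc m)
      where
      3m≤2+m² : ∀ m → 3 * m ≤ 2 + m * m
      3m≤2+m² 0 = z≤n
      3m≤2+m² 1 = ≤-refl
      3m≤2+m² 2 = ≤-refl
      3m≤2+m² (suc (suc (suc k))) = subst (3 * (3 + k) ≤_) (sym (expand k)) (m≤m+n _ _)
        where
        expand : ∀ k → 2 + (3 + k) * (3 + k) ≡ 3 * (3 + k) + (k * k + 3 * k + 2)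
        expand = solve-∀

    symPair? : ∀ i j → Dec (i Fin.< j × i ∈ B × j ∈ B × L i j ≡ L j i)
    symPair? i j = (i Fin.<? j) ×-dec (i ∈? B) ×-dec (j ∈? B) ×-dec (L i j ≟ L j i)

    symPair : Fin n → Fin n → ℕ
    symPair i j = 𝟙 (symPair? i j)

    n₂≡sum-symPair : n₂ L B ≡ sum (λ i → sum (symPair i))
    n₂≡sum-symPair = trans (sum-map-allFin (λ i → ListAction.sum (List.map (symPair i) (List.allFin n))))
                           (sum-cong-≗ {n} (λ i → sum-map-allFin (symPair i)))

    symmetric-pair≤ : ∀ i j → pairIn i j * δ (L i j) (L j i) ≤ symPair i j + symPair j i
    symmetric-pair≤ i j with Bit-* (distinctIn-Bit B (i ∷ j ∷ [])) (𝟙-Bit (L i j ≟ L j i))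
    ... | inj₁ s≡0 = ≤-trans (≤-reflexive s≡0) z≤n
    ... | inj₂ s≡1 = ≤-trans (≤-reflexive s≡1) (by-order (Fin.<-cmp i j))
      where
      Lij≡Lji = 𝟙≡1⇒ (L i j ≟ L j i) (m*n≡1⇒n≡1 (pairIn i j) _ s≡1)
      facts = distinctIn-pair⁻ (m*n≡1⇒m≡1 (pairIn i j) _ s≡1)
      i∈B = proj₁ facts
      j∈B = proj₁ (proj₂ facts)
      by-order : Tri (i Fin.< j) (i ≡ j) (j Fin.< i) → 1 ≤ symPair i j + symPair j i
      by-order (tri< i<j _ _) =
        ≤-trans (≤-reflexive (sym (𝟙-yes (symPair? i j) (i<j , i∈B , j∈B , Lij≡Lji)))) (m≤m+n (symPair i j) _)
      by-order (tri≈ _ i≡j _) = ⊥-elim (proj₂ (proj₂ facts) i≡j)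
      by-order (tri> _ _ j<i) =
        ≤-trans (≤-reflexive (sym (𝟙-yes (symPair? j i) (j<i , j∈B , i∈B , sym Lij≡Lji)))) (m≤n+m (symPair j i) _)

    symmetric≤2n₂ : symmetric ≤ 2 * n₂ L B
    symmetric≤2n₂ = begin
        symmetric
      ≤⟨ sum-mono-≤ (λ i → sum-mono-≤ (symmetric-pair≤ i)) ⟩
        sum (λ i → sum λ j → symPair i j + symPair j i)
      ≡⟨ sum-cong-≗ {n} (λ i → ∑-distrib-+ (symPair i) (λ j → symPair j i)) ⟩
        sum (λ i → sum (symPair i) + sum λ j → symPair j i)
      ≡⟨ ∑-distrib-+ (λ i → sum (symPair i)) (λ i → sum λ j → symPair j i) ⟩
        sum (λ i → sum (symPair i)) + sum (λ i → sum λ j → symPair j i)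
      ≡⟨ cong (sum (λ i → sum (symPair i)) +_) (∑-comm (λ i j → symPair j i)) ⟩
        sum (λ i → sum (symPair i)) + sum (λ i → sum (symPair i))
      ≡⟨ cong₂ _+_ n₂≡sum-symPair (trans (+-identityʳ (n₂ L B)) n₂≡sum-symPair) ⟨
        2 * n₂ L B ∎
      where open ≤-Reasoning

    pair-count-bound : 2 * (∣ B ∣ P′ 2) ≤ 2 * ∣ prime L B ∣ + 2 * n₂ L B + excess B
    pair-count-bound = +-cancelˡ-≤ C (2 * C) _ (begin
        3 * C
      ≡⟨ cong (3 *_) sum-mult ⟨
        3 * sum mult
      ≡⟨ *-distribˡ-sum 3 mult ⟩
        sum (λ x → 3 * mult x)
      ≤⟨ sum-mono-≤ 3*mult≤ ⟩
        sum (λ x → 2 * χ (prime L B) x + mult x * mult x)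
      ≡⟨ ∑-distrib-+ (λ x → 2 * χ (prime L B) x) (λ x → mult x * mult x) ⟩
        sum (λ x → 2 * χ (prime L B) x) + sum (λ x → mult x * mult x)
      ≡⟨ cong₂ _+_ (trans (sym (*-distribˡ-sum 2 (χ (prime L B)))) (cong (2 *_) (sym (∣S∣≡sum-χ (prime L B))))) sum-mult² ⟩
        2 * ∣ prime L B ∣ + ∑ᵛ 4 collisions
      ≤⟨ +-monoʳ-≤ (2 * ∣ prime L B ∣) (∑ᵛ-mono-≤ 4 collision≤) ⟩
        2 * ∣ prime L B ∣ + ∑ᵛ 4 collisionTerms
      ≡⟨ cong (2 * ∣ prime L B ∣ +_) ∑ᵛ-collisionTerms ⟩
        2 * ∣ prime L B ∣ + (C + (symmetric + (chains B + (chains B + clashes B))))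
      ≤⟨ +-monoʳ-≤ (2 * ∣ prime L B ∣) (+-monoʳ-≤ C (+-monoˡ-≤ (chains B + (chains B + clashes B)) symmetric≤2n₂)) ⟩
        2 * ∣ prime L B ∣ + (C + (2 * n₂ L B + (chains B + (chains B + clashes B))))
      ≡⟨ regroup (∣ prime L B ∣) C (n₂ L B) (chains B) (clashes B) ⟩
        C + (2 * ∣ prime L B ∣ + 2 * n₂ L B + (2 * chains B + clashes B)) ∎)
      where
      open ≤-Reasoning
      C = ∣ B ∣ P′ 2
      regroup : ∀ p c m t q → 2 * p + (c + (2 * m + (t + (t + q)))) ≡ c + (2 * p + 2 * m + (2 * t + q))
      regroup = solve-∀

module Selection {n : ℕ} (L : LatinSquare n) (isL : IsLatinSquare L) where

  open LatinCounts L isL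

  -- chains B + clashes B / 2 ≤ (b)₃/(a-2) + (b)₄/(2(a-3)), with the denominators cleared.
  Sparse : ℕ → ℕ → Subset n → Set
  Sparse a b B = (a ∸ 2) * (a ∸ 3) * excess B ≤ 2 * (a ∸ 3) * (b P′ 3) + (a ∸ 2) * (b P′ 4)

  no-triples⇒Sparse : ∀ a b B → ∣ B ∣ ≡ b → b P′ 3 ≡ 0 → Sparse a b B
  no-triples⇒Sparse a b B ∣B∣≡b no-triples = begin
      (a ∸ 2) * (a ∸ 3) * (2 * chains B + clashes B)
    ≡⟨ cong₂ (λ t q → (a ∸ 2) * (a ∸ 3) * (2 * t + q)) {chains B} {0} {clashes B} {0}
             (n≤0⇒n≡0 chains≤0) (n≤0⇒n≡0 clashes≤0) ⟩
      (a ∸ 2) * (a ∸ 3) * 0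
    ≡⟨ *-zeroʳ ((a ∸ 2) * (a ∸ 3)) ⟩
      0
    ≤⟨ z≤n ⟩
      2 * (a ∸ 3) * (b P′ 3) + (a ∸ 2) * (b P′ 4) ∎
    where
    open ≤-Reasoning
    chains≤0 : chains B ≤ 0
    chains≤0 = subst (chains B ≤_) (trans (cong (_P′ 3) ∣B∣≡b) no-triples) (chains≤P′3 B)
    clashes≤0 : clashes B ≤ 0
    clashes≤0 = subst (clashes B ≤_) (trans (cong (_P′ 4) ∣B∣≡b) (trans (cong ((b ∸ 3) *_) no-triples) (*-zeroʳ (b ∸ 3))))
                      (clashes≤P′4 B)

  averaged-chains⇒Sparse : ∀ a₀ A B → ∣ A ∣ ≡ 4 + a₀ → ∣ B ∣ ≡ 3 →
                           ((4 + a₀) P′ 3) * chains B ≤ (3 P′ 3) * chains A → Sparse (4 + a₀) 3 B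
  averaged-chains⇒Sparse a₀ A B ∣A∣≡a ∣B∣≡3 averaged = begin
      (a ∸ 2) * (a ∸ 3) * (2 * chains B + clashes B)
    ≡⟨ cong (λ q → (a ∸ 2) * (a ∸ 3) * (2 * chains B + q)) {clashes B} {0} (n≤0⇒n≡0 clashes≤0) ⟩
      (a ∸ 2) * (a ∸ 3) * (2 * chains B + 0)
    ≡⟨ rearrange (a ∸ 2) (a ∸ 3) (chains B) ⟩
      2 * (a ∸ 3) * ((a ∸ 2) * chains B)
    ≤⟨ *-monoʳ-≤ (2 * (a ∸ 3)) [a-2]chains≤6 ⟩
      2 * (a ∸ 3) * 6
    ≡⟨ trans (cong (2 * (a ∸ 3) * 6 +_) (*-zeroʳ (a ∸ 2))) (+-identityʳ (2 * (a ∸ 3) * 6)) ⟨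
      2 * (a ∸ 3) * (3 P′ 3) + (a ∸ 2) * (3 P′ 4) ∎
    where
    open ≤-Reasoning
    a = 4 + a₀
    rearrange : ∀ x y t → x * y * (2 * t + 0) ≡ 2 * y * (x * t)
    rearrange = solve-∀
    clashes≤0 : clashes B ≤ 0
    clashes≤0 = subst (clashes B ≤_) (cong (_P′ 4) ∣B∣≡3) (clashes≤P′4 B)
    [a-2]chains≤6 : (a ∸ 2) * chains B ≤ 6
    [a-2]chains≤6 = *-cancelʳ-≤ ((a ∸ 2) * chains B) 6 (a P′ 2) (begin
        (a ∸ 2) * chains B * (a P′ 2)   ≡⟨ xy∙z≈xz∙y (a ∸ 2) (chains B) (a P′ 2) ⟩
        (a P′ 3) * chains B             ≤⟨ averaged ⟩
        6 * chains A                    ≤⟨ *-monoʳ-≤ 6 (subst (chains A ≤_) (cong (_P′ 2) ∣A∣≡a) (chains≤P′2 A)) ⟩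
        6 * (a P′ 2)                    ∎)

  -- Lifting chains to 4-tuples (tupleSum-lift) turns 2·chains + c·clashes into a single order-4
  -- tuple sum, so one averaging step controls both; at |S| = c + 3 it equals c · excess S.
  weight : ℕ → Vec (Fin n) 4 → ℕ
  weight c v = 2 * chain (tail v) + c * clash v

  potential : ℕ → Subset n → ℕ
  potential c = tupleSum 4 (weight c)

  potential≡ : ∀ c S → potential c S ≡ 2 * ((∣ S ∣ ∸ 3) * chains S) + c * clashes S
  potential≡ c S = begin
      potential c S
    ≡⟨ ∑ᵛ-cong 4 (λ v → distrib (distinctIn S v) (chain (tail v)) c (clash v)) ⟩
      ∑ᵛ 4 (λ v → 2 * (distinctIn S v * chain (tail v)) + c * (distinctIn S v * clash v))
    ≡⟨ ∑ᵛ-distrib-+ 4 (λ v → 2 * (distinctIn S v * chain (tail v))) (λ v → c * (distinctIn S v * clash v)) ⟩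
      ∑ᵛ 4 (λ v → 2 * (distinctIn S v * chain (tail v))) + ∑ᵛ 4 (λ v → c * (distinctIn S v * clash v))
    ≡⟨ cong₂ _+_ (*-distribˡ-∑ᵛ 4 2 (λ v → distinctIn S v * chain (tail v)))
                 (*-distribˡ-∑ᵛ 4 c (λ v → distinctIn S v * clash v)) ⟩
      2 * tupleSum 4 (chain ∘ tail) S + c * clashes S
    ≡⟨ cong (λ t → 2 * t + c * clashes S) (tupleSum-lift 3 chain S) ⟩
      2 * ((∣ S ∣ ∸ 3) * chains S) + c * clashes S ∎
    where
    open ≡-Reasoning
    distrib : ∀ d t c q → d * (2 * t + c * q) ≡ 2 * (d * t) + c * (d * q)
    distrib = solve-∀

  averaged-potential⇒Sparse : ∀ a₀ b₀ A B → ∣ A ∣ ≡ 4 + a₀ → ∣ B ∣ ≡ 4 + b₀ →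
    ((4 + a₀) P′ 4) * potential (suc b₀) B ≤ ((4 + b₀) P′ 4) * potential (suc b₀) A →
    Sparse (4 + a₀) (4 + b₀) B
  averaged-potential⇒Sparse a₀ b₀ A B ∣A∣≡a ∣B∣≡b averaged = *-cancelˡ-≤ ((a P′ 2) * c) (begin
      (a P′ 2) * c * ((a ∸ 2) * (a ∸ 3) * excess B)
    ≡⟨ regroup (a P′ 2) c (a ∸ 2) (a ∸ 3) (excess B) ⟩
      (a P′ 4) * (c * excess B)
    ≡⟨ cong ((a P′ 4) *_) potential-B ⟨
      (a P′ 4) * potential c B
    ≤⟨ averaged ⟩
      (b P′ 4) * potential c A
    ≤⟨ *-monoʳ-≤ (b P′ 4) potential-A ⟩
      (b P′ 4) * (2 * ((a ∸ 3) * (a P′ 2)) + c * (a P′ 3))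
    ≡⟨ regroup′ (a P′ 2) c (a ∸ 2) (a ∸ 3) (b P′ 3) ⟩
      (a P′ 2) * c * (2 * (a ∸ 3) * (b P′ 3) + (a ∸ 2) * (b P′ 4)) ∎)
    where
    open ≤-Reasoning
    a = 4 + a₀
    b = 4 + b₀
    c = suc b₀
    potential-B : potential c B ≡ c * excess B
    potential-B = trans (potential≡ c B) (trans (cong (λ s → 2 * ((s ∸ 3) * chains B) + c * clashes B) ∣B∣≡b)
                                                (factor c (chains B) (clashes B)))
      where
      factor : ∀ c t q → 2 * (c * t) + c * q ≡ c * (2 * t + q)
      factor = solve-∀
    potential-A : potential c A ≤ 2 * ((a ∸ 3) * (a P′ 2)) + c * (a P′ 3)
    potential-A = begin
        potential c A
      ≡⟨ potential≡ c A ⟩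
        2 * ((∣ A ∣ ∸ 3) * chains A) + c * clashes A
      ≡⟨ cong (λ s → 2 * ((s ∸ 3) * chains A) + c * clashes A) ∣A∣≡a ⟩
        2 * ((a ∸ 3) * chains A) + c * clashes A
      ≤⟨ +-mono-≤ (*-monoʳ-≤ 2 (*-monoʳ-≤ (a ∸ 3) (subst (chains A ≤_) (cong (_P′ 2) ∣A∣≡a) (chains≤P′2 A))))
                  (*-monoʳ-≤ c (subst (clashes A ≤_) (cong (_P′ 3) ∣A∣≡a) (clashes≤P′3 A))) ⟩
        2 * ((a ∸ 3) * (a P′ 2)) + c * (a P′ 3) ∎
    regroup : ∀ f c x y w → f * c * (x * y * w) ≡ y * (x * f) * (c * w)
    regroup = solve-∀
    regroup′ : ∀ f c x y g → c * g * (2 * (y * f) + c * (x * f)) ≡ f * c * (2 * y * g + x * (c * g))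
    regroup′ = solve-∀

  ∃-Sparse-of-no-triples : ∀ {a b} (A : Subset n) → ∣ A ∣ ≡ a → b ≤ a → b P′ 3 ≡ 0 →
                           ∃ λ B → B ⊆ A × ∣ B ∣ ≡ b × Sparse a b B
  ∃-Sparse-of-no-triples {a} {b} A ∣A∣≡a b≤a no-triples =
    let B , B⊆A , ∣B∣≡b , _ = Averaging.averaging 0 (λ _ → 0) (λ S → ≤-reflexive (tupleSum-remove 0 (λ _ → 0) S))
                                                  z≤n b≤a A ∣A∣≡a
    in B , B⊆A , ∣B∣≡b , no-triples⇒Sparse a b B ∣B∣≡b no-triples

  ∃-Sparse : ∀ a₀ (A : Subset n) → ∣ A ∣ ≡ 4 + a₀ →
             ∀ b → b ≤ 4 + a₀ → ∃ λ B → B ⊆ A × ∣ B ∣ ≡ b × Sparse (4 + a₀) b B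
  ∃-Sparse a₀ A ∣A∣≡a 0 b≤a = ∃-Sparse-of-no-triples A ∣A∣≡a b≤a refl
  ∃-Sparse a₀ A ∣A∣≡a 1 b≤a = ∃-Sparse-of-no-triples A ∣A∣≡a b≤a refl
  ∃-Sparse a₀ A ∣A∣≡a 2 b≤a = ∃-Sparse-of-no-triples A ∣A∣≡a b≤a refl
  ∃-Sparse a₀ A ∣A∣≡a 3 b≤a =
    let B , B⊆A , ∣B∣≡3 , averaged =
          Averaging.averaging 3 chains (λ S → ≤-reflexive (tupleSum-remove 3 chain S)) ≤-refl b≤a A ∣A∣≡a
    in B , B⊆A , ∣B∣≡3 , averaged-chains⇒Sparse a₀ A B ∣A∣≡a ∣B∣≡3 averaged
  ∃-Sparse a₀ A ∣A∣≡a (suc (suc (suc (suc b₀)))) b≤a =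
    let B , B⊆A , ∣B∣≡b , averaged =
          Averaging.averaging 4 (potential (suc b₀)) (λ S → ≤-reflexive (tupleSum-remove 4 (weight (suc b₀)) S))
                              (s≤s (s≤s (s≤s (s≤s z≤n)))) b≤a A ∣A∣≡a
    in B , B⊆A , ∣B∣≡b , averaged-potential⇒Sparse a₀ b₀ A B ∣A∣≡a ∣B∣≡b averaged

  Sparse⇒counting-bound : ∀ a b B → ∣ B ∣ ≡ b → Sparse a b B →
    (a ∸ 2) * (2 * (a ∸ 3)) * (b P′ 2) ≤
      (a ∸ 2) * (2 * (a ∸ 3)) * (∣ prime L B ∣ + n₂ L B) + 2 * (a ∸ 3) * (b P′ 3) + (a ∸ 2) * (b P′ 4)
  Sparse⇒counting-bound a b B ∣B∣≡b sparse = begin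
      x * (2 * y) * (b P′ 2)
    ≡⟨ x*[2y]*z≡x*y*[2z] x y (b P′ 2) ⟩
      x * y * (2 * (b P′ 2))
    ≤⟨ *-monoʳ-≤ (x * y) (subst (λ s → 2 * (s P′ 2) ≤ _) ∣B∣≡b (pair-count-bound B)) ⟩
      x * y * (2 * ∣ prime L B ∣ + 2 * n₂ L B + excess B)
    ≡⟨ distrib x y (∣ prime L B ∣) (n₂ L B) (excess B) ⟩
      x * (2 * y) * (∣ prime L B ∣ + n₂ L B) + x * y * excess B
    ≤⟨ +-monoʳ-≤ (x * (2 * y) * (∣ prime L B ∣ + n₂ L B)) sparse ⟩
      x * (2 * y) * (∣ prime L B ∣ + n₂ L B) + (2 * y * (b P′ 3) + x * (b P′ 4))
    ≡⟨ +-assoc (x * (2 * y) * (∣ prime L B ∣ + n₂ L B)) (2 * y * (b P′ 3)) (x * (b P′ 4)) ⟨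
      x * (2 * y) * (∣ prime L B ∣ + n₂ L B) + 2 * y * (b P′ 3) + x * (b P′ 4) ∎
    where
    open ≤-Reasoning
    x = a ∸ 2
    y = a ∸ 3
    x*[2y]*z≡x*y*[2z] : ∀ x y z → x * (2 * y) * z ≡ x * y * (2 * z)
    x*[2y]*z≡x*y*[2z] = solve-∀
    distrib : ∀ x y p m e → x * y * (2 * p + 2 * m + e) ≡ x * (2 * y) * (p + m) + x * y * e
    distrib = solve-∀

module ClearDenominators where

  open import Data.Integer as ℤ using (ℤ; +_)
  import Data.Integer.Properties as ℤ
  import Data.Integer.Tactic.RingSolver as ℤ
  open import Data.Rational as ℚ using (ℚ; _/_)
  import Data.Rational.Properties as ℚ
  open import Data.Rational.Solver using (module +-*-Solver)
  open import Data.Rational.Unnormalised as ℚᵘ using (mkℚᵘ; *≡*; *≤*)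
  import Data.Rational.Unnormalised.Properties as ℚᵘ
  import Data.Nat as ℕ
  import Data.Nat.Properties as ℕ

  toℚᵘ-ℤtoℚ : ∀ z → ℚ.toℚᵘ (ℤtoℚ z) ℚᵘ.≃ mkℚᵘ z 0
  toℚᵘ-ℤtoℚ z = ℚ.toℚᵘ-fromℚᵘ (mkℚᵘ z 0)

  ℤtoℚ-+ : ∀ x y → ℤtoℚ (x ℤ.+ y) ≡ ℤtoℚ x ℚ.+ ℤtoℚ y
  ℤtoℚ-+ x y = ℚ.toℚᵘ-injective (ℚᵘ.≃-trans (toℚᵘ-ℤtoℚ (x ℤ.+ y)) (ℚᵘ.≃-trans (*≡* (+-over-1 x y))
    (ℚᵘ.≃-sym (ℚᵘ.≃-trans (ℚ.toℚᵘ-homo-+ (ℤtoℚ x) (ℤtoℚ y)) (ℚᵘ.+-cong (toℚᵘ-ℤtoℚ x) (toℚᵘ-ℤtoℚ y))))))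
    where
    +-over-1 : ∀ x y → (x ℤ.+ y) ℤ.* + 1 ≡ (x ℤ.* + 1 ℤ.+ y ℤ.* + 1) ℤ.* + 1
    +-over-1 = ℤ.solve-∀

  ℤtoℚ-* : ∀ x y → ℤtoℚ (x ℤ.* y) ≡ ℤtoℚ x ℚ.* ℤtoℚ y
  ℤtoℚ-* x y = ℚ.toℚᵘ-injective (ℚᵘ.≃-trans (toℚᵘ-ℤtoℚ (x ℤ.* y)) (ℚᵘ.≃-trans (*≡* refl)
    (ℚᵘ.≃-sym (ℚᵘ.≃-trans (ℚ.toℚᵘ-homo-* (ℤtoℚ x) (ℤtoℚ y)) (ℚᵘ.*-cong (toℚᵘ-ℤtoℚ x) (toℚᵘ-ℤtoℚ y))))))

  ℤtoℚ-neg : ∀ x → ℤtoℚ (ℤ.- x) ≡ ℚ.- ℤtoℚ x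
  ℤtoℚ-neg x = ℚ.toℚᵘ-injective (ℚᵘ.≃-trans (toℚᵘ-ℤtoℚ (ℤ.- x))
    (ℚᵘ.≃-sym (ℚᵘ.≃-trans (ℚ.toℚᵘ-homo‿- (ℤtoℚ x)) (ℚᵘ.-‿cong (toℚᵘ-ℤtoℚ x)))))

  ℤtoℚ-- : ∀ x y → ℤtoℚ (x ℤ.- y) ≡ ℤtoℚ x ℚ.- ℤtoℚ y
  ℤtoℚ-- x y = trans (ℤtoℚ-+ x (ℤ.- y)) (cong (ℤtoℚ x ℚ.+_) (ℤtoℚ-neg y))

  ℤtoℚ-mono-≤ : ∀ {x y} → x ℤ.≤ y → ℤtoℚ x ℚ.≤ ℤtoℚ y
  ℤtoℚ-mono-≤ {x} {y} x≤y = ℚ.toℚᵘ-cancel-≤ (ℚᵘ.≤-respˡ-≃ (ℚᵘ.≃-sym (toℚᵘ-ℤtoℚ x))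
    (ℚᵘ.≤-respʳ-≃ (ℚᵘ.≃-sym (toℚᵘ-ℤtoℚ y)) (*≤* (ℤ.*-monoʳ-≤-nonNeg (+ 1) x≤y))))

  /ₙ-*-cancel : ∀ z m .{{_ : NonZero m}} → (z /ₙ m) ℚ.* ℤtoℚ (+ m) ≡ ℤtoℚ z
  /ₙ-*-cancel z (suc d) = ℚ.toℚᵘ-injective (ℚᵘ.≃-trans (ℚ.toℚᵘ-homo-* (z / suc d) (ℤtoℚ (+ suc d)))
    (ℚᵘ.≃-trans (ℚᵘ.*-cong (ℚ.toℚᵘ-fromℚᵘ (mkℚᵘ z d)) (toℚᵘ-ℤtoℚ (+ suc d)))
    (ℚᵘ.≃-trans (*≡* (trans (ℤ.*-identityʳ (z ℤ.* + suc d)) (cong (λ e → z ℤ.* + suc e) (sym (ℕ.*-identityʳ d)))))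
    (ℚᵘ.≃-sym (toℚᵘ-ℤtoℚ z)))))

  P′≡0 : ∀ n k → n ℕ.< k → n P′ k ≡ 0
  P′≡0 n (suc k) n<1+k with ℕ.m≤n⇒m<n∨m≡n (ℕ.s≤s⁻¹ n<1+k)
  ... | inj₁ n<k  rewrite P′≡0 n k n<k = ℕ.*-zeroʳ (n ℕ.∸ k)
  ... | inj₂ refl rewrite ℕ.n∸n≡0 n   = refl

  falling : ℤ → ℕ → ℤ
  falling x zero    = + 1
  falling x (suc k) = (x ℤ.- + k) ℤ.* falling x k

  +P′≡falling : ∀ n k → + (n P′ k) ≡ falling (+ n) k
  +P′≡falling n zero    = refl
  +P′≡falling n (suc k) with k ℕ.≤? n
  ... | yes k≤n = trans (ℤ.pos-* (n ℕ.∸ k) (n P′ k))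
                        (cong₂ ℤ._*_ (sym (trans (ℤ.m-n≡m⊖n n k) (ℤ.⊖-≥ k≤n))) (+P′≡falling n k))
  ... | no  k≰n = trans (cong +_ (trans (cong ((n ℕ.∸ k) ℕ.*_) n<k⇒0) (ℕ.*-zeroʳ (n ℕ.∸ k))))
                        (sym (trans (cong ((+ n ℤ.- + k) ℤ.*_) (trans (sym (+P′≡falling n k)) (cong ℤ.+_ n<k⇒0)))
                                    (ℤ.*-zeroʳ (+ n ℤ.- + k))))
    where
    n<k⇒0 = P′≡0 n k (ℕ.≰⇒> k≰n)

  module _ (β : ℤ) where

    pairs triples-per-pair quadruples-per-pair : ℤ
    pairs = β ℤ.* (β ℤ.- + 1)
    triples-per-pair = β ℤ.- + 2
    quadruples-per-pair = (β ℤ.- + 2) ℤ.* (β ℤ.- + 3)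

    falling-2 : falling β 2 ≡ pairs
    falling-2 = expand β
      where
      expand : ∀ β → (β ℤ.- + 1) ℤ.* ((β ℤ.- + 0) ℤ.* + 1) ≡ β ℤ.* (β ℤ.- + 1)
      expand = ℤ.solve-∀

    falling-3 : falling β 3 ≡ pairs ℤ.* triples-per-pair
    falling-3 = trans (cong ((β ℤ.- + 2) ℤ.*_) falling-2) (ℤ.*-comm (β ℤ.- + 2) pairs)

    falling-4 : falling β 4 ≡ pairs ℤ.* quadruples-per-pair
    falling-4 = trans (cong ((β ℤ.- + 3) ℤ.*_) falling-3) (expand pairs (β ℤ.- + 2) (β ℤ.- + 3))
      where
      expand : ∀ Y u v → v ℤ.* (Y ℤ.* u) ≡ Y ℤ.* (u ℤ.* v)
      expand = ℤ.solve-∀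

  -- (bound a b - m) · x · y for x = a - 2, y = 2 (a - 3), computed in ℤ.
  cleared : ℤ → ℤ → ℤ → ℤ → ℤ
  cleared x y β m =
    pairs β ℤ.* x ℤ.* y ℤ.- pairs β ℤ.* triples-per-pair β ℤ.* y ℤ.- pairs β ℤ.* quadruples-per-pair β ℤ.* x
    ℤ.- m ℤ.* (x ℤ.* y)

  cleared≤ : ∀ x y b p m →
    x ℕ.* y ℕ.* (b P′ 2) ℕ.≤ x ℕ.* y ℕ.* (p ℕ.+ m) ℕ.+ y ℕ.* (b P′ 3) ℕ.+ x ℕ.* (b P′ 4) →
    cleared (+ x) (+ y) (+ b) (+ m) ℤ.≤ + p ℤ.* (+ x ℤ.* + y)
  cleared≤ x y b p m counted =
    subst₂ ℤ._≤_ (lhs (+ x) (+ y) Y u w (+ m)) (rhs (+ x) (+ y) Y u w (+ p) (+ m))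
           (ℤ.+-monoˡ-≤ (ℤ.- E) (subst₂ ℤ._≤_ toℤ-lhs toℤ-rhs (ℤ.+≤+ counted)))
    where
    Y = pairs (+ b)
    u = triples-per-pair (+ b)
    w = quadruples-per-pair (+ b)
    E = + y ℤ.* (Y ℤ.* u) ℤ.+ + x ℤ.* (Y ℤ.* w) ℤ.+ + m ℤ.* (+ x ℤ.* + y)
    toℤ-lhs : + (x ℕ.* y ℕ.* (b P′ 2)) ≡ + x ℤ.* + y ℤ.* Y
    toℤ-lhs = trans (ℤ.pos-* (x ℕ.* y) _) (cong₂ ℤ._*_ (ℤ.pos-* x y) (trans (+P′≡falling b 2) (falling-2 (+ b))))
    toℤ-rhs : + (x ℕ.* y ℕ.* (p ℕ.+ m) ℕ.+ y ℕ.* (b P′ 3) ℕ.+ x ℕ.* (b P′ 4)) ≡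
              + x ℤ.* + y ℤ.* (+ p ℤ.+ + m) ℤ.+ + y ℤ.* (Y ℤ.* u) ℤ.+ + x ℤ.* (Y ℤ.* w)
    toℤ-rhs = trans (ℤ.pos-+ _ (x ℕ.* (b P′ 4))) (cong₂ ℤ._+_
      (trans (ℤ.pos-+ (x ℕ.* y ℕ.* (p ℕ.+ m)) _) (cong₂ ℤ._+_
        (trans (ℤ.pos-* (x ℕ.* y) _) (cong₂ ℤ._*_ (ℤ.pos-* x y) (ℤ.pos-+ p m)))
        (trans (ℤ.pos-* y _) (cong (+ y ℤ.*_) (trans (+P′≡falling b 3) (falling-3 (+ b)))))))
      (trans (ℤ.pos-* x _) (cong (+ x ℤ.*_) (trans (+P′≡falling b 4) (falling-4 (+ b))))))
    lhs : ∀ x y Y u w m →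
      x ℤ.* y ℤ.* Y ℤ.+ ℤ.- (y ℤ.* (Y ℤ.* u) ℤ.+ x ℤ.* (Y ℤ.* w) ℤ.+ m ℤ.* (x ℤ.* y))
      ≡ Y ℤ.* x ℤ.* y ℤ.- Y ℤ.* u ℤ.* y ℤ.- Y ℤ.* w ℤ.* x ℤ.- m ℤ.* (x ℤ.* y)
    lhs = ℤ.solve-∀
    rhs : ∀ x y Y u w p m →
      x ℤ.* y ℤ.* (p ℤ.+ m) ℤ.+ y ℤ.* (Y ℤ.* u) ℤ.+ x ℤ.* (Y ℤ.* w)
        ℤ.+ ℤ.- (y ℤ.* (Y ℤ.* u) ℤ.+ x ℤ.* (Y ℤ.* w) ℤ.+ m ℤ.* (x ℤ.* y))
      ≡ p ℤ.* (x ℤ.* y)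
    rhs = ℤ.solve-∀

  ℤtoℚ-*-*ʳ : ∀ x y z → ℤtoℚ (x ℤ.* y ℤ.* z) ≡ ℤtoℚ x ℚ.* ℤtoℚ y ℚ.* ℤtoℚ z
  ℤtoℚ-*-*ʳ x y z = trans (ℤtoℚ-* (x ℤ.* y) z) (cong (ℚ._* ℤtoℚ z) (ℤtoℚ-* x y))

  bound-cleared : ∀ a₀ b m → let x = + (2 ℕ.+ a₀); y = + (2 ℕ.* suc a₀) in
    (bound (4 ℕ.+ a₀) b ℚ.- ℕtoℚ m) ℚ.* ℤtoℚ (x ℤ.* y) ≡ ℤtoℚ (cleared x y (+ b) (+ m))
  bound-cleared a₀ b m = begin
      (Ŷ ℚ.* (ℚ.1ℚ ℚ.- α ℚ.- β) ℚ.- M) ℚ.* ℤtoℚ (x ℤ.* y)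
    ≡⟨ cong ((Ŷ ℚ.* (ℚ.1ℚ ℚ.- α ℚ.- β) ℚ.- M) ℚ.*_) (ℤtoℚ-* x y) ⟩
      (Ŷ ℚ.* (ℚ.1ℚ ℚ.- α ℚ.- β) ℚ.- M) ℚ.* (X ℚ.* Y)
    ≡⟨ expand Ŷ α β M X Y ⟩
      Ŷ ℚ.* X ℚ.* Y ℚ.- Ŷ ℚ.* (α ℚ.* X) ℚ.* Y ℚ.- Ŷ ℚ.* (β ℚ.* Y) ℚ.* X ℚ.- M ℚ.* (X ℚ.* Y)
    ≡⟨ cong₂ (λ s t → Ŷ ℚ.* X ℚ.* Y ℚ.- Ŷ ℚ.* s ℚ.* Y ℚ.- Ŷ ℚ.* t ℚ.* X ℚ.- M ℚ.* (X ℚ.* Y))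
             (/ₙ-*-cancel u (2 ℕ.+ a₀)) (/ₙ-*-cancel w (2 ℕ.* suc a₀)) ⟩
      Ŷ ℚ.* X ℚ.* Y ℚ.- Ŷ ℚ.* ℤtoℚ u ℚ.* Y ℚ.- Ŷ ℚ.* ℤtoℚ w ℚ.* X ℚ.- M ℚ.* (X ℚ.* Y)
    ≡⟨ pushed ⟨
      ℤtoℚ (cleared x y (+ b) (+ m)) ∎
    where
    open ≡-Reasoning
    open +-*-Solver
    x = + (2 ℕ.+ a₀)
    y = + (2 ℕ.* suc a₀)
    u = triples-per-pair (+ b)
    w = quadruples-per-pair (+ b)
    Ŷ = ℤtoℚ (pairs (+ b))
    X = ℤtoℚ x
    Y = ℤtoℚ y
    M = ℕtoℚ m
    α = u /ₙ (2 ℕ.+ a₀)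
    β = w /ₙ (2 ℕ.* suc a₀)
    expand : ∀ y a b m p q → (y ℚ.* (ℚ.1ℚ ℚ.- a ℚ.- b) ℚ.- m) ℚ.* (p ℚ.* q) ≡
             y ℚ.* p ℚ.* q ℚ.- y ℚ.* (a ℚ.* p) ℚ.* q ℚ.- y ℚ.* (b ℚ.* q) ℚ.* p ℚ.- m ℚ.* (p ℚ.* q)
    expand = solve 6 (λ y a b m p q → (y :* (con ℚ.1ℚ :- a :- b) :- m) :* (p :* q) :=
                      y :* p :* q :- y :* (a :* p) :* q :- y :* (b :* q) :* p :- m :* (p :* q)) refl
    Ŷx Ŷu Ŷw : ℤ → ℤ
    Ŷx t = pairs (+ b) ℤ.* x ℤ.* t
    Ŷu t = pairs (+ b) ℤ.* u ℤ.* t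
    Ŷw t = pairs (+ b) ℤ.* w ℤ.* t
    pushed : ℤtoℚ (cleared x y (+ b) (+ m)) ≡
             Ŷ ℚ.* X ℚ.* Y ℚ.- Ŷ ℚ.* ℤtoℚ u ℚ.* Y ℚ.- Ŷ ℚ.* ℤtoℚ w ℚ.* X ℚ.- M ℚ.* (X ℚ.* Y)
    pushed =
      trans (ℤtoℚ-- (Ŷx y ℤ.- Ŷu y ℤ.- Ŷw x) (+ m ℤ.* (x ℤ.* y))) (cong₂ ℚ._-_
        (trans (ℤtoℚ-- (Ŷx y ℤ.- Ŷu y) (Ŷw x)) (cong₂ ℚ._-_
          (trans (ℤtoℚ-- (Ŷx y) (Ŷu y)) (cong₂ ℚ._-_
            (ℤtoℚ-*-*ʳ (pairs (+ b)) x y) (ℤtoℚ-*-*ʳ (pairs (+ b)) u y)))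
          (ℤtoℚ-*-*ʳ (pairs (+ b)) w x)))
        (trans (ℤtoℚ-* (+ m) (x ℤ.* y)) (cong (M ℚ.*_) (ℤtoℚ-* x y))))

  bound≤ : ∀ a₀ b p m → let x = 2 ℕ.+ a₀; y = 2 ℕ.* suc a₀ in
    x ℕ.* y ℕ.* (b P′ 2) ℕ.≤ x ℕ.* y ℕ.* (p ℕ.+ m) ℕ.+ y ℕ.* (b P′ 3) ℕ.+ x ℕ.* (b P′ 4) →
    bound (4 ℕ.+ a₀) b ℚ.- ℕtoℚ m ℚ.≤ ℕtoℚ p
  bound≤ a₀ b p m counted =
    ℚ.*-cancelʳ-≤-pos r {{ℚ.normalize-pos ((2 ℕ.+ a₀) ℕ.* (2 ℕ.* suc a₀)) 1}} (begin
      (bound (4 ℕ.+ a₀) b ℚ.- ℕtoℚ m) ℚ.* r  ≡⟨ bound-cleared a₀ b m ⟩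
      ℤtoℚ (cleared x y (+ b) (+ m))       ≤⟨ ℤtoℚ-mono-≤ (cleared≤ (2 ℕ.+ a₀) (2 ℕ.* suc a₀) b p m counted) ⟩
      ℤtoℚ (+ p ℤ.* (x ℤ.* y))             ≡⟨ ℤtoℚ-* (+ p) (x ℤ.* y) ⟩
      ℕtoℚ p ℚ.* r                         ∎)
    where
    open ℚ.≤-Reasoning
    x = + (2 ℕ.+ a₀)
    y = + (2 ℕ.* suc a₀)
    r = ℤtoℚ (x ℤ.* y)

open ClearDenominators using (bound≤)

lemma3p1 : (n : ℕ) (L : LatinSquare n) → IsLatinSquare L →
    (A : Subset n) (a : ℕ) → ∣ A ∣ ≡ a → 4 ≤ a →
    (b : ℕ) → b ≤ a →
    ∃ λ (B : Subset n) → B ⊆ A × ∣ B ∣ ≡ b ×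
      bound a b ℚ.- ℕtoℚ (n₂ L B) ℚ.≤ ℕtoℚ ∣ prime L B ∣
lemma3p1 n L isL A _ ∣A∣≡a (s≤s (s≤s (s≤s (s≤s {n = a₀} _)))) b b≤a =
  let B , B⊆A , ∣B∣≡b , sparse = ∃-Sparse a₀ A ∣A∣≡a b b≤a
  in B , B⊆A , ∣B∣≡b ,
     bound≤ a₀ b ∣ prime L B ∣ (n₂ L B) (Sparse⇒counting-bound (4 + a₀) b B ∣B∣≡b sparse)
  where open Selection L isL
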